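{- Let $M$ be an $n\times n$ dissimilarity matrix and $0\le m<n$. If some $(n-m)\times(n-m)$ principal submatrix of $M$ has tree rank $r$, then $M$ has tree rank at most $r+m$.
   Context: An $n\times n$ dissimilarity matrix is a function from 2-element subsets of $[n]$ to $\mathbb{R}$; a principal submatrix is its restriction to pairs within a subset of $[n]$. A tree matrix is a dissimilarity matrix $D$ such that for all distinct $i,j,k,l$ the minimum of $D_{ij}+D_{kl}$, $D_{ik}+D_{jl}$, $D_{il}+D_{jk}$ is attained at least twice. The tree rank of $M$ is the least $r$ such that $M$ is the entrywise minimum of $r$ tree matrices. -}

module Defs where

open import Level using (Level; suc; _⊔_)
open import Data.Nat using (ℕ; _∸_) renaming (_≤_ to _≤ℕ_; _<_ to _<ℕ_; _+_ to _+ℕ_)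
open import Data.Fin using (Fin) renaming (_<_ to _<ᶠ_)
open import Data.Product using (Σ; _×_; ∃; ∃-syntax; _,_)
open import Data.Sum using (_⊎_)
open import Relation.Binary.PropositionalEquality using (_≡_; _≢_)
open import Relation.Binary.Structures using (IsTotalOrder)
open import Algebra.Structures using (IsAbelianGroup)
open import Relation.Nullary using (¬_)

-- A totally ordered abelian group (the value domain of the entries; ℝ is an
-- instance).  Equality is propositional.
record OrderedAbelianGroup (a ℓ : Level) : Set (suc (a ⊔ ℓ)) where
  infixl 6 _+_
  infix 4 _≤_
  field
    Carrier : Set a
    _+_ : Carrier → Carrier → Carrier
    0# : Carrier
    -_ : Carrier → Carrier
    _≤_ : Carrier → Carrier → Set ℓ
    isAbelianGroup : IsAbelianGroup _≡_ _+_ 0# -_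
    isTotalOrder : IsTotalOrder _≡_ _≤_
    +-monoˡ-≤ : ∀ {x y} z → x ≤ y → x + z ≤ y + z

module _ {a ℓ : Level} (G : OrderedAbelianGroup a ℓ) where
  open OrderedAbelianGroup G

  -- An n×n dissimilarity matrix: a function on 2-element subsets of [n],
  -- represented as a symmetric function on pairs of distinct indices
  -- (values on the diagonal are irrelevant and never consulted).
  record Dissim (n : ℕ) : Set a where
    field
      entry : Fin n → Fin n → Carrier
      symm  : ∀ i j → i ≢ j → entry i j ≡ entry j i
  open Dissim public

  MinTwice : Carrier → Carrier → Carrier → Set (a ⊔ ℓ)
  MinTwice x y z = (x ≡ y × x ≤ z) ⊎ (x ≡ z × x ≤ y) ⊎ (y ≡ z × y ≤ x)

  Distinct4 : ∀ {n} → Fin n → Fin n → Fin n → Fin n → Set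
  Distinct4 i j k l = i ≢ j × i ≢ k × i ≢ l × j ≢ k × j ≢ l × k ≢ l

  IsTreeMatrix : ∀ {n} → Dissim n → Set (a ⊔ ℓ)
  IsTreeMatrix {n} D = ∀ (i j k l : Fin n) → Distinct4 i j k l →
    MinTwice (entry D i j + entry D k l) (entry D i k + entry D j l)
             (entry D i l + entry D j k)

  IsEntrywiseMin : ∀ {n r} → Dissim n → (Fin r → Dissim n) → Set (a ⊔ ℓ)
  IsEntrywiseMin {n} {r} M T = ∀ (i j : Fin n) → i ≢ j →
    (∃[ t ] entry M i j ≡ entry (T t) i j) × (∀ t → entry M i j ≤ entry (T t) i j)

  MinOfTrees : ∀ {n} → Dissim n → ℕ → Set (a ⊔ ℓ)
  MinOfTrees {n} M r = Σ (Fin r → Dissim n) λ T →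
    (∀ t → IsTreeMatrix (T t)) × IsEntrywiseMin M T

  HasTreeRank : ∀ {n} → Dissim n → ℕ → Set (a ⊔ ℓ)
  HasTreeRank M r = MinOfTrees M r × (∀ s → s <ℕ r → ¬ MinOfTrees M s)

  TreeRankAtMost : ∀ {n} → Dissim n → ℕ → Set (a ⊔ ℓ)
  TreeRankAtMost M k = ∃[ s ] (s ≤ℕ k × MinOfTrees M s)

  -- principal submatrix on the subset given by a strictly increasing map
  -- f : Fin k → Fin n (i.e. the subset {f 0 < … < f (k-1)} of [n])
  StrictlyIncreasing : ∀ {k n} → (Fin k → Fin n) → Set
  StrictlyIncreasing f = ∀ i j → i <ᶠ j → f i <ᶠ f j

  principalSubmatrix : ∀ {k n} → Dissim n → (f : Fin k → Fin n) →
                       StrictlyIncreasing f → Dissim k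
  principalSubmatrix M f inc = record
    { entry = λ i j → entry M (f i) (f j)
    ; symm  = λ i j i≢j → symm M (f i) (f j) (λ e → i≢j (inj i j e))
    }
    where
    open import Data.Fin.Properties using (<-cmp)
    open import Relation.Binary.Definitions using (tri<; tri≈; tri>)
    open import Data.Fin.Properties using (<-irrefl)
    open import Relation.Binary.PropositionalEquality using (sym)
    open import Data.Empty using (⊥-elim)
    inj : ∀ i j → f i ≡ f j → i ≡ j
    inj i j e with <-cmp i j
    ... | tri< p _ _ = ⊥-elim (<-irrefl e (inc i j p))
    ... | tri≈ _ q _ = q
    ... | tri> _ _ p = ⊥-elim (<-irrefl (sym e) (inc j i p))

module Submission where

-- Let S = f([n ∸ m]) ⊆ [n] and let the principal submatrix M|S be the entrywise
-- minimum of tree matrices T₁ … T_r.  Let p₁ … p_L (L ≤ m) be the points outside S.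
--
-- Each Tₜ extends to a tree matrix Eₜ on [n] that agrees with Tₜ on S
--    and dominates M everywhere: retract the outside points onto a fixed point q ∈ S,
--    put a large value Δ on the diagonal of Tₜ so that the four-point condition also
--    holds with repeated indices, and add a large weight W at every outside point.
--  * Stars.  For an outside point p, the matrix u(i) + u(j) with u(p) = -K and
--    u(i) = M(p,i) + K is a tree matrix equal to M on the pairs containing p and
--    dominating M on all other pairs, provided K is large.
--
-- Pairs inside S are attained by some Eₜ and pairs meeting an outside point by a star,
-- so M is the minimum of these r + L tree matrices.

open import Defs
open import Level using (Level; _⊔_)
import Data.Nat as ℕ
open import Data.Nat using (ℕ; zero; suc; _∸_)
import Data.Nat.Properties as ℕ
open import Data.Fin using (Fin; zero; suc; fromℕ<; _↑ˡ_; _↑ʳ_; splitAt; join)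
open import Data.Fin.Properties using (_≟_; any?; join-splitAt; injective⇒≤; <-cmp; <-irrefl)
open import Data.Product using (Σ; _×_; ∃; ∃-syntax; _,_; proj₁; proj₂)
open import Data.Sum using (_⊎_; inj₁; inj₂; [_,_])
open import Data.Empty using (⊥-elim)
open import Data.List using (List; filter; length; lookup; allFin)
import Data.List.Relation.Unary.All as All
open import Data.List.Relation.Unary.AllPairs using (_∷_)
open import Data.List.Relation.Unary.Unique.Propositional using (Unique)
open import Data.List.Relation.Unary.Unique.Propositional.Properties using (allFin⁺; filter⁺)
open import Data.List.Membership.Propositional using (_∈_)
open import Data.List.Membership.Propositional.Properties using (∈-filter⁺; ∈-filter⁻; ∈-allFin; ∈-lookup)
open import Data.List.Relation.Unary.Any using (index)
open import Data.List.Relation.Unary.Any.Properties using (lookup-index)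
open import Data.Vec.Functional using (_++_)
open import Data.Vec.Functional.Properties using (lookup-++ˡ; lookup-++ʳ)
open import Data.Vec.Functional.Relation.Unary.All.Properties using (++⁺)
open import Function.Definitions using (Injective)
open import Relation.Nullary using (¬_; Dec; yes; no)
open import Relation.Nullary.Decidable using (¬?)
open import Relation.Binary.PropositionalEquality
  using (_≡_; _≢_; refl; sym; trans; cong; cong₂; module ≡-Reasoning)
open import Relation.Binary.Definitions using (tri<; tri≈; tri>)
open import Relation.Binary.Structures using (IsTotalOrder)
open import Algebra.Bundles using (CommutativeMonoid)
open import Algebra.Structures using (IsAbelianGroup)

open ≡-Reasoning

InImage : ∀ {k n} → (Fin k → Fin n) → Fin n → Set
InImage f i = ∃ λ x → f x ≡ i

inImage? : ∀ {k n} (f : Fin k → Fin n) (i : Fin n) → Dec (InImage f i)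
inImage? f i = any? (λ x → f x ≟ i)

lookup-injective : ∀ {A : Set} {xs : List A} → Unique xs → Injective _≡_ _≡_ (lookup xs)
lookup-injective (_ ∷ _) {zero} {zero} _ = refl
lookup-injective (x∉xs ∷ _) {zero} {suc t} e = ⊥-elim (All.lookup x∉xs (∈-lookup t) e)
lookup-injective (x∉xs ∷ _) {suc s} {zero} e = ⊥-elim (All.lookup x∉xs (∈-lookup s) (sym e))
lookup-injective (_ ∷ xs-unique) {suc s} {suc t} e = cong suc (lookup-injective xs-unique e)

++-injective : ∀ {k L n} {xs : Fin k → Fin n} {ys : Fin L → Fin n} →
               Injective _≡_ _≡_ xs → Injective _≡_ _≡_ ys → (∀ x y → xs x ≢ ys y) →
               Injective _≡_ _≡_ (xs ++ ys)
++-injective {k} {L} {xs = xs} {ys} xs-inj ys-inj disjoint {s} {t} e = begin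
  s                       ≡⟨ join-splitAt k L s ⟨
  join k L (splitAt k s)  ≡⟨ cong (join k L) (sum-injective (splitAt k s) (splitAt k t) e) ⟩
  join k L (splitAt k t)  ≡⟨ join-splitAt k L t ⟩
  t                       ∎
  where
  sum-injective : ∀ u v → [ xs , ys ] u ≡ [ xs , ys ] v → u ≡ v
  sum-injective (inj₁ x) (inj₁ y) e = cong inj₁ (xs-inj e)
  sum-injective (inj₁ x) (inj₂ y) e = ⊥-elim (disjoint x y e)
  sum-injective (inj₂ x) (inj₁ y) e = ⊥-elim (disjoint y x (sym e))
  sum-injective (inj₂ x) (inj₂ y) e = cong inj₂ (ys-inj e)

-- The points outside the image of an injection f : Fin k → Fin n are listed by an
-- L-tuple g with k + L ≤ n (pigeonhole applied to f followed by g).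
outsideEnumeration : ∀ {k n} (f : Fin k → Fin n) → Injective _≡_ _≡_ f →
  ∃[ L ] Σ (Fin L → Fin n) λ g → k ℕ.+ L ℕ.≤ n × (∀ i → ¬ InImage f i → ∃[ s ] g s ≡ i)
outsideEnumeration {k} {n} f f-inj = length outside , lookup outside , k+L≤n , covers
  where
  outside? : (i : Fin n) → Dec (¬ InImage f i)
  outside? i = ¬? (inImage? f i)

  outside : List (Fin n)
  outside = filter outside? (allFin n)

  disjoint : ∀ x s → f x ≢ lookup outside s
  disjoint x s e = proj₂ (∈-filter⁻ outside? {xs = allFin n} (∈-lookup s)) (x , e)

  k+L≤n : k ℕ.+ length outside ℕ.≤ n
  k+L≤n = injective⇒≤ (++-injective f-inj (lookup-injective (filter⁺ outside? (allFin⁺ n))) disjoint)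

  covers : ∀ i → ¬ InImage f i → ∃[ s ] lookup outside s ≡ i
  covers i i∉f = index i∈ , sym (lookup-index i∈)
    where
    i∈ : i ∈ outside
    i∈ = ∈-filter⁺ outside? (∈-allFin i) i∉f

module _ {a ℓ : Level} (G : OrderedAbelianGroup a ℓ) where
  open OrderedAbelianGroup G
  open IsAbelianGroup isAbelianGroup using (assoc; comm; identityˡ; identityʳ; inverseˡ; inverseʳ)
  open IsTotalOrder isTotalOrder using (total; reflexive) renaming (refl to ≤-refl; trans to ≤-trans)

  +-commutativeMonoid : CommutativeMonoid a a
  +-commutativeMonoid = record
    { isCommutativeMonoid = IsAbelianGroup.isCommutativeMonoid isAbelianGroup }

  open import Algebra.Solver.CommutativeMonoid +-commutativeMonoid
    using (solve; _⊜_; id) renaming (_⊕_ to _+′_)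

  strictlyIncreasing⇒injective : ∀ {k n} {f : Fin k → Fin n} →
                                 StrictlyIncreasing G f → Injective _≡_ _≡_ f
  strictlyIncreasing⇒injective inc {x} {y} e with <-cmp x y
  ... | tri< x<y _ _ = ⊥-elim (<-irrefl e (inc x y x<y))
  ... | tri≈ _ x≡y _ = x≡y
  ... | tri> _ _ y<x = ⊥-elim (<-irrefl (sym e) (inc y x y<x))

  ≤-respects : ∀ {x x′ y y′} → x ≡ x′ → y ≡ y′ → x ≤ y → x′ ≤ y′
  ≤-respects refl refl x≤y = x≤y

  +-monoʳ-≤ : ∀ {x y} z → x ≤ y → z + x ≤ z + y
  +-monoʳ-≤ {x} {y} z x≤y = ≤-respects (comm x z) (comm y z) (+-monoˡ-≤ z x≤y)

  +-mono-≤ : ∀ {x x′ y y′} → x ≤ x′ → y ≤ y′ → x + y ≤ x′ + y′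
  +-mono-≤ {x′ = x′} {y} x≤x′ y≤y′ = ≤-trans (+-monoˡ-≤ y x≤x′) (+-monoʳ-≤ x′ y≤y′)

  ≤-+ʳ : ∀ {x z} → 0# ≤ z → x ≤ x + z
  ≤-+ʳ {x} 0≤z = ≤-respects (identityʳ x) refl (+-monoʳ-≤ x 0≤z)

  ≤-+ˡ : ∀ {x z} → 0# ≤ z → x ≤ z + x
  ≤-+ˡ {x} 0≤z = ≤-respects (identityˡ x) refl (+-monoˡ-≤ x 0≤z)

  [x+y]-y≡x : ∀ x y → x + y + - y ≡ x
  [x+y]-y≡x x y = begin
    x + y + - y    ≡⟨ assoc x y (- y) ⟩
    x + (y + - y)  ≡⟨ cong (x +_) (inverseʳ y) ⟩
    x + 0#         ≡⟨ identityʳ x ⟩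
    x              ∎

  -y+[x+y]≡x : ∀ x y → - y + (x + y) ≡ x
  -y+[x+y]≡x x y = trans (comm (- y) (x + y)) ([x+y]-y≡x x y)

  y+[x-y]≡x : ∀ x y → y + (x + - y) ≡ x
  y+[x-y]≡x x y = begin
    y + (x + - y)  ≡⟨ comm y (x + - y) ⟩
    x + - y + y    ≡⟨ assoc x (- y) y ⟩
    x + (- y + y)  ≡⟨ cong (x +_) (inverseˡ y) ⟩
    x + 0#         ≡⟨ identityʳ x ⟩
    x              ∎

  ≤-from-difference : ∀ {x y b} → x + - y ≤ b → x ≤ y + b
  ≤-from-difference {x} {y} x-y≤b = ≤-respects (y+[x-y]≡x x y) refl (+-monoʳ-≤ y x-y≤b)

  -- Finite upper bounds.  All the large constants of the proof (Δ, W, K) are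
  -- nonnegative upper bounds of finitely many group elements.

  record UpperBound {A : Set} (g : A → Carrier) : Set (a ⊔ ℓ) where
    field
      bound  : Carrier
      nonneg : 0# ≤ bound
      bounds : ∀ x → g x ≤ bound
  open UpperBound

  Bounded : Set → Set (a ⊔ ℓ)
  Bounded A = (g : A → Carrier) → UpperBound g

  Fin-bounded : ∀ k → Bounded (Fin k)
  Fin-bounded zero g = record { bound = 0# ; nonneg = ≤-refl ; bounds = λ () }
  Fin-bounded (suc k) g with Fin-bounded k (λ i → g (suc i))
  ... | record { bound = b ; nonneg = 0≤b ; bounds = tail≤b } with total (g zero) b
  ...   | inj₁ g₀≤b = record
          { bound = b ; nonneg = 0≤b ; bounds = λ { zero → g₀≤b ; (suc i) → tail≤b i } }
  ...   | inj₂ b≤g₀ = record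
          { bound = g zero ; nonneg = ≤-trans 0≤b b≤g₀
          ; bounds = λ { zero → ≤-refl ; (suc i) → ≤-trans (tail≤b i) b≤g₀ } }

  ×-bounded : ∀ {A B : Set} → Bounded A → Bounded B → Bounded (A × B)
  ×-bounded A-bounded B-bounded g = record
    { bound = bound outer ; nonneg = nonneg outer
    ; bounds = λ (x , y) → ≤-trans (bounds (slice x) y) (bounds outer x) }
    where
    slice : ∀ x → UpperBound (λ y → g (x , y))
    slice x = B-bounded (λ y → g (x , y))
    outer : UpperBound (λ x → bound (slice x))
    outer = A-bounded (λ x → bound (slice x))

  Fin²-bounded : ∀ k → Bounded (Fin k × Fin k)
  Fin²-bounded k = ×-bounded (Fin-bounded k) (Fin-bounded k)

  FourPoint : {A : Set} → (A → A → Carrier) → A → A → A → A → Set (a ⊔ ℓ)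
  FourPoint d i j k l = MinTwice G (d i j + d k l) (d i k + d j l) (d i l + d j k)

  minTwice-cast : ∀ {x y z x′ y′ z′} → x ≡ x′ → y ≡ y′ → z ≡ z′ →
                  MinTwice G x y z → MinTwice G x′ y′ z′
  minTwice-cast refl refl refl m = m

  minTwice-+ : ∀ {x y z} s → MinTwice G x y z → MinTwice G (x + s) (y + s) (z + s)
  minTwice-+ s (inj₁ (x≡y , x≤z)) = inj₁ (cong (_+ s) x≡y , +-monoˡ-≤ s x≤z)
  minTwice-+ s (inj₂ (inj₁ (x≡z , x≤y))) = inj₂ (inj₁ (cong (_+ s) x≡z , +-monoˡ-≤ s x≤y))
  minTwice-+ s (inj₂ (inj₂ (y≡z , y≤x))) = inj₂ (inj₂ (cong (_+ s) y≡z , +-monoˡ-≤ s y≤x))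

  _⊕_ : {A : Set} → (A → A → Carrier) → (A → Carrier) → A → A → Carrier
  (d ⊕ u) i j = d i j + u i + u j

  -- Each of the three pairings of i j k l sums the four weights exactly once, so adding
  -- weights translates all three sums by the same amount.
  fourPoint-⊕ : ∀ {A : Set} (d : A → A → Carrier) (u : A → Carrier) {i j k l} →
                FourPoint d i j k l → FourPoint (d ⊕ u) i j k l
  fourPoint-⊕ d u {i} {j} {k} {l} four-point =
    minTwice-cast (pairing₁ (d i j) (d k l) (u i) (u j) (u k) (u l))
                  (pairing₂ (d i k) (d j l) (u i) (u j) (u k) (u l))
                  (pairing₃ (d i l) (d j k) (u i) (u j) (u k) (u l))
                  (minTwice-+ ((u i + u j) + (u k + u l)) four-point)
    where
    pairing₁ : ∀ x y p q r s → (x + y) + ((p + q) + (r + s)) ≡ (x + p + q) + (y + r + s)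
    pairing₁ = solve 6 (λ x y p q r s →
      (x +′ y) +′ ((p +′ q) +′ (r +′ s)) ⊜ ((x +′ p) +′ q) +′ ((y +′ r) +′ s)) refl
    pairing₂ : ∀ x y p q r s → (x + y) + ((p + q) + (r + s)) ≡ (x + p + r) + (y + q + s)
    pairing₂ = solve 6 (λ x y p q r s →
      (x +′ y) +′ ((p +′ q) +′ (r +′ s)) ⊜ ((x +′ p) +′ r) +′ ((y +′ q) +′ s)) refl
    pairing₃ : ∀ x y p q r s → (x + y) + ((p + q) + (r + s)) ≡ (x + p + s) + (y + q + r)
    pairing₃ = solve 6 (λ x y p q r s →
      (x +′ y) +′ ((p +′ q) +′ (r +′ s)) ⊜ ((x +′ p) +′ s) +′ ((y +′ q) +′ r)) refl

  ⊕-dissim : ∀ {n} (d : Fin n → Fin n → Carrier) → (∀ i j → d i j ≡ d j i) →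
             (Fin n → Carrier) → Dissim G n
  ⊕-dissim d d-sym u = record
    { entry = d ⊕ u
    ; symm  = λ i j _ → trans (cong (λ x → x + u i + u j) (d-sym i j)) (swap (d j i) (u i) (u j)) }
    where
    swap : ∀ x p q → x + p + q ≡ x + q + p
    swap = solve 3 (λ x p q → (x +′ p) +′ q ⊜ (x +′ q) +′ p) refl

  ⊕-tree : ∀ {n} (d : Fin n → Fin n → Carrier) (d-sym : ∀ i j → d i j ≡ d j i) u →
           (∀ i j k l → FourPoint d i j k l) → IsTreeMatrix G (⊕-dissim d d-sym u)
  ⊕-tree d d-sym u four-point i j k l _ = fourPoint-⊕ d u (four-point i j k l)

  Dominates : ∀ {n} → Dissim G n → Dissim G n → Set ℓ
  Dominates M E = ∀ i j → i ≢ j → entry M i j ≤ entry E i j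

  -- A tree matrix D whose diagonal is set to a large Δ satisfies
  -- the four-point condition for all quadruples, distinct or not.  "Large" means
  -- D(a,c) ≤ Δ and D(a,c) + D(a,d) ≤ Δ + D(c,d).
  module Padding {k} (D : Dissim G k) (D-tree : IsTreeMatrix G D) (Δ : Carrier)
                 (Δ-pair : ∀ a c → entry D a c ≤ Δ)
                 (Δ-triple : ∀ a c d → entry D a c + entry D a d ≤ Δ + entry D c d) where

    abstract
      padded : Fin k → Fin k → Carrier
      padded a b with a ≟ b
      ... | yes _ = Δ
      ... | no  _ = entry D a b

      padded-diag : ∀ a → padded a a ≡ Δ
      padded-diag a with a ≟ a
      ... | yes _   = refl
      ... | no  a≢a = ⊥-elim (a≢a refl)

      padded-off : ∀ {a b} → a ≢ b → padded a b ≡ entry D a b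
      padded-off {a} {b} a≢b with a ≟ b
      ... | yes a≡b = ⊥-elim (a≢b a≡b)
      ... | no  _   = refl

    padded-sym : ∀ a b → padded a b ≡ padded b a
    padded-sym a b with a ≟ b
    ... | yes refl = refl
    ... | no  a≢b  = begin
      padded a b   ≡⟨ padded-off a≢b ⟩
      entry D a b  ≡⟨ symm D a b a≢b ⟩
      entry D b a  ≡⟨ padded-off (λ b≡a → a≢b (sym b≡a)) ⟨
      padded b a   ∎

    padded-≤Δ : ∀ a c → padded a c ≤ Δ
    padded-≤Δ a c with a ≟ c
    ... | yes refl = reflexive (padded-diag a)
    ... | no  a≢c  = ≤-respects (sym (padded-off a≢c)) refl (Δ-pair a c)

    padded-repeated : ∀ a c d → padded a c + padded a d ≤ padded a a + padded c d
    padded-repeated a c d with c ≟ d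
    ... | yes refl = ≤-respects refl (sym (cong₂ _+_ (padded-diag a) (padded-diag c)))
                       (+-mono-≤ (padded-≤Δ a c) (padded-≤Δ a c))
    ... | no c≢d with a ≟ c
    ...   | yes refl = ≤-refl
    ...   | no a≢c with a ≟ d
    ...     | yes refl = reflexive (trans (comm _ _) (cong (padded a a +_) (padded-sym a c)))
    ...     | no a≢d = ≤-respects (sym (cong₂ _+_ (padded-off a≢c) (padded-off a≢d)))
                                  (sym (cong₂ _+_ (padded-diag a) (padded-off c≢d)))
                                  (Δ-triple a c d)

    padded-fourPoint : ∀ a b c d → FourPoint padded a b c d
    padded-fourPoint a b c d with a ≟ b
    ... | yes refl = inj₂ (inj₂ (comm _ _ , padded-repeated a c d))
    ... | no a≢b with a ≟ c
    ...   | yes refl = inj₂ (inj₁ (trans (comm _ _) (cong (padded a d +_) (padded-sym a b)) ,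
                                   padded-repeated a b d))
    ...   | no a≢c with a ≟ d
    ...     | yes refl = inj₁ (trans (comm _ _) (cong₂ _+_ (padded-sym c a) (padded-sym a b)) ,
                               ≤-respects (cong (padded a b +_) (padded-sym a c)) refl
                                          (padded-repeated a b c))
    ...     | no a≢d with b ≟ c
    ...       | yes refl = inj₁ (refl , ≤-respects (cong (_+ padded b d) (padded-sym b a)) (comm _ _)
                                                   (padded-repeated b a d))
    ...       | no b≢c with b ≟ d
    ...         | yes refl = inj₂ (inj₁ (cong (padded a b +_) (padded-sym c b) ,
                                         ≤-respects (cong₂ _+_ (padded-sym b a) (padded-sym b c))
                                                    (comm _ _) (padded-repeated b a c)))
    ...         | no b≢d with c ≟ d
    ...           | yes refl = inj₂ (inj₂ (refl , ≤-respects (cong₂ _+_ (padded-sym c a) (padded-sym c b))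
                                                             (comm _ _) (padded-repeated c a b)))
    ...           | no c≢d = minTwice-cast (sym (cong₂ _+_ (padded-off a≢b) (padded-off c≢d)))
                                           (sym (cong₂ _+_ (padded-off a≢c) (padded-off b≢d)))
                                           (sym (cong₂ _+_ (padded-off a≢d) (padded-off b≢c)))
                                           (D-tree a b c d (a≢b , a≢c , a≢d , b≢c , b≢d , c≢d))

  module Extension {k n} (M : Dissim G n) (f : Fin k → Fin n) (f-inj : Injective _≡_ _≡_ f)
                   (q : Fin k) (D : Dissim G k) (D-tree : IsTreeMatrix G D)
                   (D-dominates : ∀ x y → x ≢ y → entry M (f x) (f y) ≤ entry D x y) where

    pair-ub : UpperBound (λ (a , c) → entry D a c)
    pair-ub = Fin²-bounded k _

    triple-ub : UpperBound (λ (a , (c , d)) → entry D a c + entry D a d + - entry D c d)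
    triple-ub = ×-bounded (Fin-bounded k) (Fin²-bounded k) _

    Δ : Carrier
    Δ = bound pair-ub + bound triple-ub

    Δ-pair : ∀ a c → entry D a c ≤ Δ
    Δ-pair a c = ≤-trans (bounds pair-ub (a , c)) (≤-+ʳ (nonneg triple-ub))

    Δ-triple : ∀ a c d → entry D a c + entry D a d ≤ Δ + entry D c d
    Δ-triple a c d = ≤-respects refl (comm _ _)
      (≤-trans (≤-from-difference (bounds triple-ub (a , (c , d))))
               (+-monoʳ-≤ (entry D c d) (≤-+ˡ (nonneg pair-ub))))

    open Padding D D-tree Δ Δ-pair Δ-triple

    W-ub : UpperBound (λ ((a , b) , (i , j)) → entry M i j + - padded a b)
    W-ub = ×-bounded (Fin²-bounded k) (Fin²-bounded n) _

    W : Carrier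
    W = bound W-ub

    W-bound : ∀ a b i j → entry M i j ≤ padded a b + W
    W-bound a b i j = ≤-from-difference (bounds W-ub ((a , b) , (i , j)))

    ρ : Fin n → Fin k
    ρ i with inImage? f i
    ... | yes (x , _) = x
    ... | no  _       = q

    w : Fin n → Carrier
    w i with inImage? f i
    ... | yes _ = 0#
    ... | no  _ = W

    ρ-f : ∀ x → ρ (f x) ≡ x
    ρ-f x with inImage? f (f x)
    ... | yes (y , fy≡fx) = f-inj fy≡fx
    ... | no  fx∉f        = ⊥-elim (fx∉f (x , refl))

    w-f : ∀ x → w (f x) ≡ 0#
    w-f x with inImage? f (f x)
    ... | yes _    = refl
    ... | no fx∉f  = ⊥-elim (fx∉f (x , refl))

    w-outside : ∀ {i} → ¬ InImage f i → w i ≡ W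
    w-outside {i} i∉f with inImage? f i
    ... | yes i∈f = ⊥-elim (i∉f i∈f)
    ... | no  _   = refl

    w-nonneg : ∀ i → 0# ≤ w i
    w-nonneg i with inImage? f i
    ... | yes _ = ≤-refl
    ... | no  _ = nonneg W-ub

    retracted : Fin n → Fin n → Carrier
    retracted i j = padded (ρ i) (ρ j)

    retracted-sym : ∀ i j → retracted i j ≡ retracted j i
    retracted-sym i j = padded-sym (ρ i) (ρ j)

    E : Dissim G n
    E = ⊕-dissim retracted retracted-sym w

    E-tree : IsTreeMatrix G E
    E-tree = ⊕-tree retracted retracted-sym w
                    (λ i j k l → padded-fourPoint (ρ i) (ρ j) (ρ k) (ρ l))

    E-agrees : ∀ x y → x ≢ y → entry E (f x) (f y) ≡ entry D x y
    E-agrees x y x≢y = begin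
      padded (ρ (f x)) (ρ (f y)) + w (f x) + w (f y)
        ≡⟨ cong₂ (λ s t → s + w (f x) + t) (cong₂ padded (ρ-f x) (ρ-f y)) (w-f y) ⟩
      padded x y + w (f x) + 0#  ≡⟨ identityʳ _ ⟩
      padded x y + w (f x)       ≡⟨ cong (padded x y +_) (w-f x) ⟩
      padded x y + 0#            ≡⟨ identityʳ _ ⟩
      padded x y                 ≡⟨ padded-off x≢y ⟩
      entry D x y                ∎

    -- A pair meeting an outside point carries the weight W, which dominates M.
    outside-dominates : ∀ i j → w i ≡ W ⊎ w j ≡ W → entry M i j ≤ entry E i j
    outside-dominates i j (inj₁ wi≡W) = ≤-trans (W-bound (ρ i) (ρ j) i j)
      (≤-trans (reflexive (cong (padded (ρ i) (ρ j) +_) (sym wi≡W))) (≤-+ʳ (w-nonneg j)))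
    outside-dominates i j (inj₂ wj≡W) = ≤-trans (W-bound (ρ i) (ρ j) i j)
      (≤-respects refl (cong (padded (ρ i) (ρ j) + w i +_) (sym wj≡W)) (+-monoˡ-≤ W (≤-+ʳ (w-nonneg i))))

    E-dominates : Dominates M E
    E-dominates i j i≢j = by-cases (inImage? f i) (inImage? f j)
      where
      by-cases : Dec (InImage f i) → Dec (InImage f j) → entry M i j ≤ entry E i j
      by-cases (yes (x , refl)) (yes (y , refl)) =
        ≤-respects refl (sym (E-agrees x y x≢y)) (D-dominates x y x≢y)
        where
        x≢y : x ≢ y
        x≢y x≡y = i≢j (cong f x≡y)
      by-cases (no i∉f) _        = outside-dominates i j (inj₁ (w-outside i∉f))
      by-cases (yes _)  (no j∉f) = outside-dominates i j (inj₂ (w-outside j∉f))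

  module Star {n} (M : Dissim G n) (p : Fin n) where

    K-ub : UpperBound (λ (i , j) → entry M i j + - (entry M p i + entry M p j))
    K-ub = Fin²-bounded n _

    K : Carrier
    K = bound K-ub

    K-bound : ∀ i j → entry M i j ≤ (entry M p i + entry M p j) + K
    K-bound i j = ≤-from-difference (bounds K-ub (i , j))

    u : Fin n → Carrier
    u i with i ≟ p
    ... | yes _ = - K
    ... | no  _ = entry M p i + K

    u-centre : u p ≡ - K
    u-centre with p ≟ p
    ... | yes _   = refl
    ... | no  p≢p = ⊥-elim (p≢p refl)

    u-other : ∀ {i} → i ≢ p → u i ≡ entry M p i + K
    u-other {i} i≢p with i ≟ p
    ... | yes i≡p = ⊥-elim (i≢p i≡p)
    ... | no  _   = refl

    star : Dissim G n
    star = ⊕-dissim (λ _ _ → 0#) (λ _ _ → refl) u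

    star-tree : IsTreeMatrix G star
    star-tree = ⊕-tree (λ _ _ → 0#) (λ _ _ → refl) u (λ _ _ _ _ → inj₁ (refl , ≤-refl))

    star-attains : ∀ i j → i ≢ j → p ≡ i ⊎ p ≡ j → entry M i j ≡ entry star i j
    star-attains _ j p≢j (inj₁ refl) = sym (begin
      0# + u p + u j                 ≡⟨ cong₂ (λ s t → 0# + s + t) u-centre (u-other (λ j≡p → p≢j (sym j≡p))) ⟩
      0# + - K + (entry M p j + K)   ≡⟨ cong (_+ (entry M p j + K)) (identityˡ (- K)) ⟩
      - K + (entry M p j + K)        ≡⟨ -y+[x+y]≡x (entry M p j) K ⟩
      entry M p j                    ∎)
    star-attains i _ i≢p (inj₂ refl) = sym (begin
      0# + u i + u p                 ≡⟨ cong₂ (λ s t → 0# + s + t) (u-other i≢p) u-centre ⟩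
      0# + (entry M p i + K) + - K   ≡⟨ cong (_+ - K) (identityˡ _) ⟩
      entry M p i + K + - K          ≡⟨ [x+y]-y≡x (entry M p i) K ⟩
      entry M p i                    ≡⟨ symm M p i (λ p≡i → i≢p (sym p≡i)) ⟩
      entry M i p                    ∎)

    star-far : ∀ {i j} → i ≢ p → j ≢ p → entry M i j ≤ entry star i j
    star-far {i} {j} i≢p j≢p = ≤-trans (K-bound i j) (≤-respects refl rearrange
      (+-monoʳ-≤ (entry M p i + entry M p j) (≤-+ʳ (nonneg K-ub))))
      where
      rearrange : (entry M p i + entry M p j) + (K + K) ≡ 0# + u i + u j
      rearrange = trans (solve 3 (λ x y z → (x +′ y) +′ (z +′ z) ⊜ (id +′ (x +′ z)) +′ (y +′ z)) refl
                               (entry M p i) (entry M p j) K)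
                        (sym (cong₂ (λ s t → 0# + s + t) (u-other i≢p) (u-other j≢p)))

    star-dominates : Dominates M star
    star-dominates i j i≢j = by-cases (i ≟ p) (j ≟ p)
      where
      by-cases : Dec (i ≡ p) → Dec (j ≡ p) → entry M i j ≤ entry star i j
      by-cases (yes i≡p) _         = reflexive (star-attains i j i≢j (inj₁ (sym i≡p)))
      by-cases (no _)    (yes j≡p) = reflexive (star-attains i j i≢j (inj₂ (sym j≡p)))
      by-cases (no i≢p)  (no j≢p)  = star-far i≢p j≢p

  minOfTrees-fromSubmatrix : ∀ {k n r L} (M : Dissim G n) (f : Fin k → Fin n)
    (inc : StrictlyIncreasing G f) → Fin k →
    (g : Fin L → Fin n) → (∀ i → ¬ InImage f i → ∃[ s ] g s ≡ i) →
    MinOfTrees G (principalSubmatrix G M f inc) r → MinOfTrees G M (r ℕ.+ L)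
  minOfTrees-fromSubmatrix {n = n} {r} {L} M f inc q g g-covers (T , T-trees , T-min) =
    trees , ++⁺ (IsTreeMatrix G) Ext.E-tree S.star-tree ,
    λ i j i≢j → attained i j i≢j , λ t → dominating t i j i≢j
    where
    module Ext (t : Fin r) = Extension M f (strictlyIncreasing⇒injective inc) q (T t) (T-trees t)
                                       (λ x y x≢y → proj₂ (T-min x y x≢y) t)
    module S (s : Fin L) = Star M (g s)

    trees : Fin (r ℕ.+ L) → Dissim G n
    trees = Ext.E ++ S.star

    dominating : ∀ t → Dominates M (trees t)
    dominating = ++⁺ (Dominates M) Ext.E-dominates S.star-dominates

    entry-at : ∀ i j {E E′} → E ≡ E′ → entry M i j ≡ entry E′ i j → entry M i j ≡ entry E i j
    entry-at i j refl M≡E = M≡E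

    attained : ∀ i j → i ≢ j → ∃[ t ] entry M i j ≡ entry (trees t) i j
    attained i j i≢j = by-cases (inImage? f i) (inImage? f j)
      where
      by-cases : Dec (InImage f i) → Dec (InImage f j) → ∃[ t ] entry M i j ≡ entry (trees t) i j
      by-cases (yes (x , refl)) (yes (y , refl)) =
        let (t , M≡T) = proj₁ (T-min x y x≢y) in
        t ↑ˡ L , entry-at i j (lookup-++ˡ Ext.E S.star t)
                   (trans M≡T (sym (Ext.E-agrees t x y x≢y)))
        where
        x≢y : x ≢ y
        x≢y x≡y = i≢j (cong f x≡y)
      by-cases (no i∉f) _ =
        let (s , gs≡i) = g-covers i i∉f in
        r ↑ʳ s , entry-at i j (lookup-++ʳ Ext.E S.star s) (S.star-attains s i j i≢j (inj₁ gs≡i))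
      by-cases (yes _) (no j∉f) =
        let (s , gs≡j) = g-covers j j∉f in
        r ↑ʳ s , entry-at i j (lookup-++ʳ Ext.E S.star s) (S.star-attains s i j i≢j (inj₂ gs≡j))

open import Data.Nat using (_<_; _+_; _≤_)

lemma5p6 : ∀ {a ℓ : Level} (G : OrderedAbelianGroup a ℓ) (n m r : ℕ) → m < n →
    (M : Dissim G n) →
    (f : Fin (n ∸ m) → Fin n) (inc : StrictlyIncreasing G f) →
    HasTreeRank G (principalSubmatrix G M f inc) r →
    TreeRankAtMost G M (r + m)
lemma5p6 G n m r m<n M f inc (T-min , _)
  with outsideEnumeration f (strictlyIncreasing⇒injective G inc)
... | L , g , k+L≤n , g-covers =
  r + L , ℕ.+-monoʳ-≤ r L≤m , minOfTrees-fromSubmatrix G M f inc q g g-covers T-min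
  where
  -- the submatrix is nonempty since m < n
  q : Fin (n ∸ m)
  q = fromℕ< (ℕ.m<n⇒0<n∸m m<n)

  -- (n ∸ m) + L ≤ n = (n ∸ m) + m
  L≤m : L ≤ m
  L≤m = ℕ.+-cancelˡ-≤ (n ∸ m) L m
          (ℕ.≤-trans k+L≤n (ℕ.≤-reflexive (sym (ℕ.m∸n+n≡m (ℕ.<⇒≤ m<n)))))
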